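{- Let $n\ge2$ and $\lambda=(\lambda_1,\dots,\lambda_d)$ a partition of $n$ (positive integer parts). For distinct $i,j\in\{0,\dots,n-2\}$, we have $i\preceq j$ in $P(\lambda)$ if and only if $i<j$ and for each $t\in\{1,\dots,d\}$ one of the following holds: (1) $s_{t,i}>s_{t,j}>0$; (2) $s_{t,i}=0$ and $s_{t,j}=s_{t,j-i}$; (3) $s_{t,j}=s_{t,i}>0$ and $s_{t,j-i}=0$.
   Context: $\Delta_\lambda=\mathrm{conv}(e_1,\dots,e_d,\lambda)\subset\mathbb{R}^d$ ($e_i$ standard basis vectors), with fundamental parallelepiped $\Pi_\lambda=\{\sum_{i=1}^d\gamma_i(1,e_i)+\gamma_{d+1}(1,\lambda): 0\le\gamma_i<1\}$. The poset $P(\lambda)$ is $\Pi_\lambda\cap\mathbb{Z}^{d+1}$ with $\sigma\preceq\mu$ iff $\mu-\sigma\in\Pi_\lambda\cap\mathbb{Z}^{d+1}$; its elements are identified with $b\in\{0,\dots,n-2\}$ via the bijection $b\mapsto p(b)=\big((\sum_{t}\lceil b\lambda_t/(n-1)\rceil)-b,\lceil b\lambda_1/(n-1)\rceil,\dots,\lceil b\lambda_d/(n-1)\rceil\big)$. For $0\le i<n-1$ and each $t$, integers $r_{t,i}\ge0$ and $0\le s_{t,i}<n-1$ are defined by $i\lambda_t=r_{t,i}(n-1)+s_{t,i}$. -}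

module Defs where

open import Data.Nat as ℕ using (ℕ; zero; suc; _≤_; _<_; NonZero; s≤s; z≤n; _∸_)
open import Data.Nat.DivMod using (_%_)
open import Data.Fin using (Fin; toℕ)
import Data.Fin as F
open import Data.Integer as ℤ using (ℤ; +_)
open import Data.Rational as ℚ using (ℚ; 0ℚ; 1ℚ; ceiling)
open import Data.Product using (Σ; _×_)
open import Data.Sum using (_⊎_)
open import Relation.Binary.PropositionalEquality using (_≡_)

sumℕ : ∀ {d} → (Fin d → ℕ) → ℕ
sumℕ {zero} f = 0
sumℕ {suc d} f = f F.zero ℕ.+ sumℕ (λ i → f (F.suc i))

sumℤ : ∀ {d} → (Fin d → ℤ) → ℤ
sumℤ {zero} f = + 0
sumℤ {suc d} f = f F.zero ℤ.+ sumℤ (λ i → f (F.suc i))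

sumℚ : ∀ {d} → (Fin d → ℚ) → ℚ
sumℚ {zero} f = 0ℚ
sumℚ {suc d} f = f F.zero ℚ.+ sumℚ (λ i → f (F.suc i))

ℤ→ℚ : ℤ → ℚ
ℤ→ℚ z = z ℚ./ 1

IsPartition : ∀ {d} → ℕ → (Fin d → ℕ) → Set
IsPartition {d} n lam =
  (∀ t → 1 ≤ lam t) × (sumℕ lam ≡ n) × (∀ t u → toℕ t ≤ toℕ u → lam u ≤ lam t)

nz : ∀ {n} → 2 ≤ n → NonZero (n ∸ 1)
nz {suc (suc k)} (s≤s (s≤s _)) = _

ceilc : ∀ {d} (n : ℕ) → 2 ≤ n → (Fin d → ℕ) → ℕ → Fin d → ℤ
ceilc n h lam b t = ceiling (((+ (b ℕ.* lam t)) ℚ./ (n ∸ 1)) {{nz h}})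

-- Lattice points of ℤ^{d+1}, written as (0th coordinate, remaining d coordinates)
Pt : ℕ → Set
Pt d = ℤ × (Fin d → ℤ)

p : ∀ {d} (n : ℕ) → 2 ≤ n → (Fin d → ℕ) → ℕ → Pt d
p n h lam b = (sumℤ (ceilc n h lam b) ℤ.- + b) Data.Product., ceilc n h lam b

_-ᵖ_ : ∀ {d} → Pt d → Pt d → Pt d
(a Data.Product., v) -ᵖ (b Data.Product., w) = (a ℤ.- b) Data.Product., (λ t → v t ℤ.- w t)

InUnit : ℚ → Set
InUnit γ = (0ℚ ℚ.≤ γ) × (γ ℚ.< 1ℚ)

-- membership of a lattice point in the fundamental parallelepiped
-- Π_λ = { Σ_i γ_i (1,e_i) + γ_{d+1} (1,λ) : 0 ≤ γ_i < 1 }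
-- (coefficients taken rational: the generators form a basis, det = ±(1-n) ≠ 0,
--  so the coefficients of an integer point are necessarily rational)
InΠ : ∀ {d} → (Fin d → ℕ) → Pt d → Set
InΠ {d} lam (v₀ Data.Product., v) =
  Σ (Fin d → ℚ) λ γ → Σ ℚ λ γ' →
    (∀ t → InUnit (γ t)) × InUnit γ' ×
    (ℤ→ℚ v₀ ≡ sumℚ γ ℚ.+ γ') ×
    (∀ t → ℤ→ℚ (v t) ≡ γ t ℚ.+ γ' ℚ.* ℤ→ℚ (+ lam t))

-- the order of P(λ), on indices b ∈ {0,…,n-2}: i ⪯ j iff p(j) - p(i) ∈ Π_λ ∩ ℤ^{d+1}
Prec : ∀ {d} (n : ℕ) → 2 ≤ n → (Fin d → ℕ) → ℕ → ℕ → Set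
Prec n h lam i j = InΠ lam (p n h lam j -ᵖ p n h lam i)

s : ∀ {d} (n : ℕ) → 2 ≤ n → (Fin d → ℕ) → Fin d → ℕ → ℕ
s n h lam t i = ((i ℕ.* lam t) % (n ∸ 1)) {{nz h}}

Cond : ∀ {d} (n : ℕ) → 2 ≤ n → (Fin d → ℕ) → ℕ → ℕ → Fin d → Set
Cond n h lam i j t =
  (s n h lam t j < s n h lam t i × 0 < s n h lam t j)
  ⊎ (s n h lam t i ≡ 0 × s n h lam t j ≡ s n h lam t (j ∸ i))
  ⊎ (s n h lam t j ≡ s n h lam t i × 0 < s n h lam t j × s n h lam t (j ∸ i) ≡ 0)

module Submission where

-- Write N = n - 1, e = j - i and c_t(b) = ⌈b λ_t / N⌉, so that p(j) - p(i) = (Σ_t v_t - e, v) with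
-- v_t = c_t(j) - c_t(i).  If this point equals Σ_t γ_t (1, e_t) + γ' (1, λ), then comparing the first
-- coordinate with the sum of the others and using Σ_t λ_t = N + 1 forces γ' = e / N and
-- γ_t = v_t - e λ_t / N.  So the point lies in Π_λ iff 0 ≤ e < N (that is, i ≤ j) and v_t = ⌈e λ_t / N⌉
-- for every t, i.e. ⌈(A + B) / N⌉ = ⌈A / N⌉ + ⌈B / N⌉ for A = i λ_t, B = e λ_t.  If a, b, c are the
-- residues of A, B, A + B modulo N, this additivity holds iff a = 0, or b = 0, or a + b > N, and these
-- three cases are conditions (2), (3) and (1) of the statement.

open import Data.Nat as ℕ using (ℕ; zero; suc; _+_; _*_; _∸_; _≤_; _<_; z≤n; z<s; NonZero)
open import Data.Nat.Properties
open import Data.Nat.DivMod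
open import Data.Nat.Divisibility using (n∣m*n)
open import Data.Nat.Coprimality as Coprime using (1-coprimeTo)
open import Data.Nat.Tactic.RingSolver using (solve-∀)
open import Data.Integer as ℤ using (ℤ; +_; -[1+_]; +[1+_])
import Data.Integer.Properties as ℤP
open import Data.Integer.DivMod using ([n/d]*d≤n; n<s[n/ℕd]*d; div-pos-is-/ℕ)
import Data.Integer.Tactic.RingSolver as ℤRing
open import Data.Rational as ℚ using (ℚ; mkℚ; 0ℚ; 1ℚ; *≤*; *<*)
import Data.Rational.Properties as ℚP
import Data.Rational.Solver as ℚSolver
open import Data.Fin as F using (Fin)
open import Data.Product using (_×_; _,_; proj₁; proj₂; map₁)
open import Data.Sum using (_⊎_; inj₁; inj₂)
open import Data.Empty using (⊥-elim)
open import Function using (_∘_)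
open import Function.Bundles using (_⇔_; mk⇔; Equivalence)
open import Function.Construct.Composition using (_⇔-∘_)
open import Relation.Binary.PropositionalEquality
open import Relation.Binary.Definitions using (tri<; tri≈; tri>)

open import Defs

module ℚRing = ℚSolver.+-*-Solver

-- The embedding ℤ → ℚ, floors and ceilings

ℤ→ℚ-mkℚ : ∀ z → ℤ→ℚ z ≡ mkℚ z 0 (Coprime.sym (1-coprimeTo ℤ.∣ z ∣))
ℤ→ℚ-mkℚ z = ℚP.fromℚᵘ-toℚᵘ (mkℚ z 0 _)

ℤ→ℚ-homo-+ : ∀ a b → ℤ→ℚ (a ℤ.+ b) ≡ ℤ→ℚ a ℚ.+ ℤ→ℚ b
ℤ→ℚ-homo-+ a b rewrite ℤ→ℚ-mkℚ a | ℤ→ℚ-mkℚ b =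
  cong ℤ→ℚ (sym (cong₂ ℤ._+_ (ℤP.*-identityʳ a) (ℤP.*-identityʳ b)))

ℤ→ℚ-homo-* : ∀ a b → ℤ→ℚ (a ℤ.* b) ≡ ℤ→ℚ a ℚ.* ℤ→ℚ b
ℤ→ℚ-homo-* a b rewrite ℤ→ℚ-mkℚ a | ℤ→ℚ-mkℚ b = refl

ℤ→ℚ-homo‿- : ∀ a → ℤ→ℚ (ℤ.- a) ≡ ℚ.- ℤ→ℚ a
ℤ→ℚ-homo‿- (+ zero) = refl
ℤ→ℚ-homo‿- +[1+ n ] = trans (ℤ→ℚ-mkℚ -[1+ n ]) (cong ℚ.-_ (sym (ℤ→ℚ-mkℚ +[1+ n ])))
ℤ→ℚ-homo‿- -[1+ n ] = trans (ℤ→ℚ-mkℚ +[1+ n ]) (cong ℚ.-_ (sym (ℤ→ℚ-mkℚ -[1+ n ])))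

ℤ→ℚ-homo-- : ∀ a b → ℤ→ℚ (a ℤ.- b) ≡ ℤ→ℚ a ℚ.- ℤ→ℚ b
ℤ→ℚ-homo-- a b = trans (ℤ→ℚ-homo-+ a (ℤ.- b)) (cong (ℤ→ℚ a ℚ.+_) (ℤ→ℚ-homo‿- b))

ℤ→ℚ-mono-≤ : ∀ {a b} → a ℤ.≤ b → ℤ→ℚ a ℚ.≤ ℤ→ℚ b
ℤ→ℚ-mono-≤ {a} {b} a≤b rewrite ℤ→ℚ-mkℚ a | ℤ→ℚ-mkℚ b = *≤* (ℤP.*-monoʳ-≤-nonNeg (+ 1) a≤b)

ℤ→ℚ-cancel-≤ : ∀ {a b} → ℤ→ℚ a ℚ.≤ ℤ→ℚ b → a ℤ.≤ b
ℤ→ℚ-cancel-≤ {a} {b} a≤b rewrite ℤ→ℚ-mkℚ a | ℤ→ℚ-mkℚ b =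
  subst₂ ℤ._≤_ (ℤP.*-identityʳ a) (ℤP.*-identityʳ b) (ℚP.drop-*≤* a≤b)

ℤ→ℚ-mono-< : ∀ {a b} → a ℤ.< b → ℤ→ℚ a ℚ.< ℤ→ℚ b
ℤ→ℚ-mono-< {a} {b} a<b rewrite ℤ→ℚ-mkℚ a | ℤ→ℚ-mkℚ b = *<* (ℤP.*-monoʳ-<-pos (+ 1) a<b)

ℤ→ℚ-cancel-< : ∀ {a b} → ℤ→ℚ a ℚ.< ℤ→ℚ b → a ℤ.< b
ℤ→ℚ-cancel-< {a} {b} a<b rewrite ℤ→ℚ-mkℚ a | ℤ→ℚ-mkℚ b =
  subst₂ ℤ._<_ (ℤP.*-identityʳ a) (ℤP.*-identityʳ b) (ℚP.drop-*<* a<b)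

b≡s-a⇔s≡a+b : ∀ a b s → + b ≡ + s ℤ.- + a ⇔ s ≡ a + b
b≡s-a⇔s≡a+b a b s = mk⇔
  (λ eq → ℤP.+-injective (trans (s≡a+[s-a] (+ s) (+ a)) (cong (ℤ._+_ (+ a)) (sym eq))))
  (λ { refl → sym (a+b-a≡b (+ a) (+ b)) })
  where
  s≡a+[s-a] : ∀ s a → s ≡ a ℤ.+ (s ℤ.- a)
  s≡a+[s-a] = ℤRing.solve-∀
  a+b-a≡b : ∀ a b → a ℤ.+ b ℤ.- a ≡ b
  a+b-a≡b = ℤRing.solve-∀

floor-≤ : ∀ p → ℤ→ℚ (ℚ.floor p) ℚ.≤ p
floor-≤ p@(mkℚ a d _) rewrite ℤ→ℚ-mkℚ (ℚ.floor p) =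
  *≤* (subst ((a ℤ./ + suc d) ℤ.* + suc d ℤ.≤_) (sym (ℤP.*-identityʳ a)) ([n/d]*d≤n a (+ suc d)))

<-floor+1 : ∀ p → p ℚ.< ℤ→ℚ (ℚ.floor p) ℚ.+ 1ℚ
<-floor+1 p@(mkℚ a d _) rewrite sym (ℤ→ℚ-homo-+ (ℚ.floor p) (+ 1)) | ℤ→ℚ-mkℚ (ℚ.floor p ℤ.+ + 1) =
  *<* (subst₂ ℤ._<_ (sym (ℤP.*-identityʳ a)) suc-floor (n<s[n/ℕd]*d a (suc d)))
  where
  suc-floor : ℤ.suc (a ℤ./ℕ suc d) ℤ.* + suc d ≡ (a ℤ./ + suc d ℤ.+ + 1) ℤ.* + suc d
  suc-floor rewrite div-pos-is-/ℕ a (suc d) {{_}} = cong (ℤ._* + suc d) (ℤP.+-comm (+ 1) (a ℤ./ℕ suc d))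

InUnit-diff⇔ : ∀ x y → InUnit (x ℚ.- y) ⇔ (y ℚ.≤ x × x ℚ.< y ℚ.+ 1ℚ)
InUnit-diff⇔ x y = mk⇔
  (λ (0≤x-y , x-y<1) →
    subst₂ ℚ._≤_ (ℚP.+-identityˡ y) x-y+y≡x (ℚP.+-monoˡ-≤ y 0≤x-y) ,
    subst₂ ℚ._<_ x-y+y≡x (ℚP.+-comm 1ℚ y) (ℚP.+-monoˡ-< y x-y<1))
  (λ (y≤x , x<y+1) →
    subst (ℚ._≤ x ℚ.- y) (ℚP.+-inverseʳ y) (ℚP.+-monoˡ-≤ (ℚ.- y) y≤x) ,
    subst (x ℚ.- y ℚ.<_) (solve 2 (λ y o → y :+ o :- y := o) refl y 1ℚ) (ℚP.+-monoˡ-< (ℚ.- y) x<y+1))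
  where
  open ℚRing
  x-y+y≡x : x ℚ.- y ℚ.+ y ≡ x
  x-y+y≡x = solve 2 (λ x y → x :- y :+ y := x) refl x y

ceiling-InUnit : ∀ q → InUnit (ℤ→ℚ (ℚ.ceiling q) ℚ.- q)
ceiling-InUnit q@(mkℚ _ _ _) =
  subst InUnit frac-neg (Equivalence.from (InUnit-diff⇔ (ℚ.- q) _) (floor-≤ (ℚ.- q) , <-floor+1 (ℚ.- q)))
  where
  open ℚRing
  frac-neg : ℚ.- q ℚ.- ℤ→ℚ (ℚ.floor (ℚ.- q)) ≡ ℤ→ℚ (ℚ.ceiling q) ℚ.- q
  frac-neg rewrite ℤ→ℚ-homo‿- (ℚ.floor (ℚ.- q)) =
    solve 2 (λ q f → :- q :- f := :- f :- q) refl q (ℤ→ℚ (ℚ.floor (ℚ.- q)))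

<+1∧≤⇒≤ : ∀ {a b q} → ℤ→ℚ a ℚ.< q ℚ.+ 1ℚ → q ℚ.≤ ℤ→ℚ b → a ℤ.≤ b
<+1∧≤⇒≤ {a} {b} {q} a<q+1 q≤b = subst (a ℤ.≤_) (ℤP.pred-suc b)
  (ℤP.i<j⇒i≤pred[j] (ℤ→ℚ-cancel-< {a} {ℤ.suc b} (ℚP.<-≤-trans a<q+1 q+1≤suc-b)))
  where
  q+1≤suc-b : q ℚ.+ 1ℚ ℚ.≤ ℤ→ℚ (ℤ.suc b)
  q+1≤suc-b = subst (q ℚ.+ 1ℚ ℚ.≤_) (trans (ℚP.+-comm (ℤ→ℚ b) 1ℚ) (sym (ℤ→ℚ-homo-+ (+ 1) b)))
                    (ℚP.+-monoˡ-≤ 1ℚ q≤b)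

ceiling≡⇔InUnit : ∀ q z → ℚ.ceiling q ≡ z ⇔ InUnit (ℤ→ℚ z ℚ.- q)
ceiling≡⇔InUnit q z = mk⇔ (λ { refl → ceiling-InUnit q }) λ z-q∈[0,1⟩ →
  let q≤z , z<q+1 = Equivalence.to (InUnit-diff⇔ _ q) z-q∈[0,1⟩
      q≤c , c<q+1 = Equivalence.to (InUnit-diff⇔ _ q) (ceiling-InUnit q)
  in ℤP.≤-antisym (<+1∧≤⇒≤ c<q+1 q≤z) (<+1∧≤⇒≤ z<q+1 q≤c)

-- Ceiling division of natural numbers

sgn : ℕ → ℕ
sgn zero    = 0
sgn (suc _) = 1

infixl 7 _⌈/⌉_
_⌈/⌉_ : (m n : ℕ) .{{_ : NonZero n}} → ℕ
m ⌈/⌉ n = m / n + sgn (m % n)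

-- With a, b, c the residues s_{t,i}, s_{t,j-i}, s_{t,j}, the disjuncts are conditions (1), (2), (3).
ResidueCond : ℕ → ℕ → ℕ → Set
ResidueCond a b c = (c < a × 0 < c) ⊎ (a ≡ 0 × c ≡ b) ⊎ (c ≡ a × 0 < c × b ≡ 0)

sgn-pos : ∀ {m} → 0 < m → sgn m ≡ 1
sgn-pos {suc _} _ = refl

module _ {N : ℕ} .{{_ : NonZero N}} where

  ⌈/⌉-< : ∀ {m} → m < N → m ⌈/⌉ N ≡ sgn m
  ⌈/⌉-< m<N rewrite m<n⇒m/n≡0 m<N | m<n⇒m%n≡m m<N = refl

  ⌈/⌉-+-* : ∀ m q → (m + q * N) ⌈/⌉ N ≡ q + m ⌈/⌉ N
  ⌈/⌉-+-* m q = begin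
    (m + q * N) / N + sgn ((m + q * N) % N)
      ≡⟨ cong₂ _+_ (+-distrib-/-∣ʳ m (n∣m*n q)) (cong sgn ([m+kn]%n≡m%n m q N)) ⟩
    m / N + q * N / N + sgn (m % N)
      ≡⟨ cong (λ x → m / N + x + sgn (m % N)) (m*n/n≡m q N) ⟩
    m / N + q + sgn (m % N)
      ≡⟨ shuffle (m / N) q (sgn (m % N)) ⟩
    q + (m / N + sgn (m % N)) ∎
    where
    open ≡-Reasoning
    shuffle : ∀ x y z → x + y + z ≡ y + (x + z)
    shuffle = solve-∀

  sgn-bounds : ∀ {r} → r < N → r ≤ sgn r * N × sgn r * N < r + N
  sgn-bounds {zero}  _      = z≤n , ℕ.>-nonZero⁻¹ N
  sgn-bounds {suc r} 1+r<N = subst (suc r ≤_) (sym (+-identityʳ N)) (<⇒≤ 1+r<N)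
                           , subst (_< suc r + N) (sym (+-identityʳ N)) (m<n+m N z<s)

  ⌈/⌉-bounds : ∀ m → m ≤ m ⌈/⌉ N * N × m ⌈/⌉ N * N < m + N
  ⌈/⌉-bounds m =
    subst₂ _≤_ (sym m≡r+qN) (sym c*N≡) (+-monoˡ-≤ (q * N) (proj₁ r-bounds)) ,
    subst₂ _<_ (sym c*N≡) r+N+qN≡m+N (+-monoˡ-< (q * N) (proj₂ r-bounds))
    where
    r q : ℕ
    r = m % N
    q = m / N
    r-bounds : r ≤ sgn r * N × sgn r * N < r + N
    r-bounds = sgn-bounds (m%n<n m N)
    m≡r+qN : m ≡ r + q * N
    m≡r+qN = m≡m%n+[m/n]*n m N
    c*N≡ : m ⌈/⌉ N * N ≡ sgn r * N + q * N
    c*N≡ = trans (*-distribʳ-+ N q (sgn r)) (+-comm (q * N) (sgn r * N))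
    r+N+qN≡m+N : r + N + q * N ≡ m + N
    r+N+qN≡m+N = trans (swap r N (q * N)) (cong (_+ N) (sym m≡r+qN))
      where
      swap : ∀ x y z → x + y + z ≡ x + z + y
      swap = solve-∀

  ⌈/⌉-+ : ∀ A B → (A + B) ⌈/⌉ N ≡ (A / N + B / N) + (A % N + B % N) ⌈/⌉ N
  ⌈/⌉-+ A B = trans (cong (λ x → x ⌈/⌉ N) A+B≡) (⌈/⌉-+-* (A % N + B % N) (A / N + B / N))
    where
    regroup : ∀ a b x y n → a + x * n + (b + y * n) ≡ a + b + (x + y) * n
    regroup = solve-∀
    A+B≡ : A + B ≡ A % N + B % N + (A / N + B / N) * N
    A+B≡ = trans (cong₂ _+_ (m≡m%n+[m/n]*n A N) (m≡m%n+[m/n]*n B N))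
                 (regroup (A % N) (B % N) (A / N) (B / N) N)

  ⌈/⌉≡2⇔ : ∀ {x} → x < N + N → x ⌈/⌉ N ≡ 2 ⇔ N < x
  ⌈/⌉≡2⇔ {x} x<2N = mk⇔
    (λ eq → +-cancelʳ-< N N x
      (subst (_< x + N) 2N≡N+N (subst (λ c → c * N < x + N) eq (proj₂ (⌈/⌉-bounds x)))))
    (λ N<x → begin
      x ⌈/⌉ N               ≡⟨ cong (λ y → y ⌈/⌉ N) (sym (x∸N+N≡x N<x)) ⟩
      (x ∸ N + 1 * N) ⌈/⌉ N ≡⟨ ⌈/⌉-+-* (x ∸ N) 1 ⟩
      1 + (x ∸ N) ⌈/⌉ N     ≡⟨ cong suc (⌈/⌉-< (m<n+o⇒m∸n<o x N x<2N)) ⟩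
      1 + sgn (x ∸ N)       ≡⟨ cong suc (sgn-pos (m<n⇒0<n∸m N<x)) ⟩
      2                     ∎)
    where
    open ≡-Reasoning
    2N≡N+N : 2 * N ≡ N + N
    2N≡N+N = cong (_+_ N) (+-identityʳ N)
    x∸N+N≡x : N < x → x ∸ N + 1 * N ≡ x
    x∸N+N≡x N<x = trans (cong (_+_ (x ∸ N)) (+-identityʳ N)) (m∸n+n≡m (<⇒≤ N<x))

  residue-window : ∀ {a b} → b < N → a + b < N + N →
                   ((a + b) % N < a × 0 < (a + b) % N) ⇔ N < a + b
  residue-window {a} {b} b<N a+b<2N = mk⇔ to from
    where
    to : (a + b) % N < a × 0 < (a + b) % N → N < a + b
    to (c<a , 0<c) with <-cmp N (a + b)
    ... | tri< N<a+b _ _ = N<a+b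
    ... | tri≈ _ N≡a+b _ = ⊥-elim (<-irrefl (sym (trans (cong (_% N) (sym N≡a+b)) (n%n≡0 N))) 0<c)
    ... | tri> _ _ a+b<N = ⊥-elim (<⇒≱ c<a (subst (a ≤_) (sym (m<n⇒m%n≡m a+b<N)) (m≤m+n a b)))
    from : N < a + b → (a + b) % N < a × 0 < (a + b) % N
    from N<a+b = subst (_< a) (sym c≡) a+b∸N<a , subst (0 <_) (sym c≡) (m<n⇒0<n∸m N<a+b)
      where
      c≡ : (a + b) % N ≡ a + b ∸ N
      c≡ = trans (sym (m≤n⇒[n∸m]%m≡n%m (<⇒≤ N<a+b))) (m<n⇒m%n≡m (m<n+o⇒m∸n<o (a + b) N a+b<2N))
      a+b∸N<a : a + b ∸ N < a
      a+b∸N<a = subst (a + b ∸ N <_) (m+n∸n≡m a N) (∸-monoˡ-< (+-monoʳ-< a b<N) (<⇒≤ N<a+b))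

  sgn-sum⇔ResidueCond : ∀ {a b} → a < N → b < N →
                        (a + b) ⌈/⌉ N ≡ sgn a + sgn b ⇔ ResidueCond a b ((a + b) % N)
  sgn-sum⇔ResidueCond {zero} {b} _ b<N =
    mk⇔ (λ _ → inj₂ (inj₁ (refl , m<n⇒m%n≡m b<N))) (λ _ → ⌈/⌉-< b<N)
  sgn-sum⇔ResidueCond {suc a} {zero} a<N _ =
    mk⇔ (λ _ → inj₂ (inj₂ (a+0%N≡a , subst (0 <_) (sym a+0%N≡a) z<s , refl))) (λ _ → ⌈/⌉-< a+0<N)
    where
    a+0<N : suc a + 0 < N
    a+0<N = subst (_< N) (sym (+-identityʳ (suc a))) a<N
    a+0%N≡a : (suc a + 0) % N ≡ suc a
    a+0%N≡a = trans (m<n⇒m%n≡m a+0<N) (+-identityʳ (suc a))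
  sgn-sum⇔ResidueCond {suc a} {suc b} a<N b<N = mk⇔
    (λ eq → inj₁ (Equivalence.from window (Equivalence.to (⌈/⌉≡2⇔ a+b<2N) eq)))
    λ { (inj₁ c∈window)          → Equivalence.from (⌈/⌉≡2⇔ a+b<2N) (Equivalence.to window c∈window)
      ; (inj₂ (inj₁ (() , _)))
      ; (inj₂ (inj₂ (_ , _ , ()))) }
    where
    a+b<2N : suc a + suc b < N + N
    a+b<2N = +-mono-< a<N b<N
    window : ((suc a + suc b) % N < suc a × 0 < (suc a + suc b) % N) ⇔ N < suc a + suc b
    window = residue-window b<N a+b<2N

  ⌈/⌉-+⇔ResidueCond : ∀ A B →
    (A + B) ⌈/⌉ N ≡ A ⌈/⌉ N + B ⌈/⌉ N ⇔ ResidueCond (A % N) (B % N) ((A + B) % N)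
  ⌈/⌉-+⇔ResidueCond A B = mk⇔
    (λ eq → subst (ResidueCond a b) (sym %-+) (Equivalence.to residues
      (+-cancelˡ-≡ Q _ _ (trans (sym (⌈/⌉-+ A B)) (trans eq regroup)))))
    (λ rc → trans (⌈/⌉-+ A B) (trans (cong (_+_ Q)
      (Equivalence.from residues (subst (ResidueCond a b) %-+ rc))) (sym regroup)))
    where
    a b Q : ℕ
    a = A % N
    b = B % N
    Q = A / N + B / N
    residues : (a + b) ⌈/⌉ N ≡ sgn a + sgn b ⇔ ResidueCond a b ((a + b) % N)
    residues = sgn-sum⇔ResidueCond (m%n<n A N) (m%n<n B N)
    %-+ : (A + B) % N ≡ (a + b) % N
    %-+ = %-distribˡ-+ A B N
    regroup : A ⌈/⌉ N + B ⌈/⌉ N ≡ Q + (sgn a + sgn b)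
    regroup = shuffle (A / N) (sgn a) (B / N) (sgn b)
      where
      shuffle : ∀ x u y w → x + u + (y + w) ≡ x + y + (u + w)
      shuffle = solve-∀

-- Finite sums

sumℚ-cong : ∀ {d} {f g : Fin d → ℚ} → (∀ t → f t ≡ g t) → sumℚ f ≡ sumℚ g
sumℚ-cong {zero}  f≡g = refl
sumℚ-cong {suc d} f≡g = cong₂ ℚ._+_ (f≡g F.zero) (sumℚ-cong (f≡g ∘ F.suc))

sumℚ-ℤ→ℚ : ∀ {d} (f : Fin d → ℤ) → sumℚ (ℤ→ℚ ∘ f) ≡ ℤ→ℚ (sumℤ f)
sumℚ-ℤ→ℚ {zero}  f = refl
sumℚ-ℤ→ℚ {suc d} f = trans (cong (ℚ._+_ (ℤ→ℚ (f F.zero))) (sumℚ-ℤ→ℚ (f ∘ F.suc)))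
                           (sym (ℤ→ℚ-homo-+ (f F.zero) (sumℤ (f ∘ F.suc))))

sumℤ-pos : ∀ {d} (f : Fin d → ℕ) → sumℤ (+_ ∘ f) ≡ + sumℕ f
sumℤ-pos {zero}  f = refl
sumℤ-pos {suc d} f = cong (ℤ._+_ (+ f F.zero)) (sumℤ-pos (f ∘ F.suc))

sumℤ-homo-- : ∀ {d} (f g : Fin d → ℤ) → sumℤ (λ t → f t ℤ.- g t) ≡ sumℤ f ℤ.- sumℤ g
sumℤ-homo-- {zero}  f g = refl
sumℤ-homo-- {suc d} f g =
  trans (cong (ℤ._+_ (f F.zero ℤ.- g F.zero)) (sumℤ-homo-- (f ∘ F.suc) (g ∘ F.suc)))
        (interchange (f F.zero) (g F.zero) (sumℤ (f ∘ F.suc)) (sumℤ (g ∘ F.suc)))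
  where
  interchange : ∀ a b c e → a ℤ.- b ℤ.+ (c ℤ.- e) ≡ a ℤ.+ c ℤ.- (b ℤ.+ e)
  interchange = ℤRing.solve-∀

sumℚ-linear : ∀ {d} (f g : Fin d → ℚ) x → sumℚ (λ t → f t ℚ.- x ℚ.* g t) ≡ sumℚ f ℚ.- x ℚ.* sumℚ g
sumℚ-linear {zero}  f g x = solve 1 (λ x → con 0ℚ := con 0ℚ :- x :* con 0ℚ) refl x
  where open ℚRing
sumℚ-linear {suc d} f g x =
  trans (cong (ℚ._+_ (f F.zero ℚ.- x ℚ.* g F.zero)) (sumℚ-linear (f ∘ F.suc) (g ∘ F.suc) x))
        (solve 5 (λ a b c e x → (a :- x :* b) :+ (c :- x :* e) := (a :+ c) :- x :* (b :+ e)) refl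
               (f F.zero) (g F.zero) (sumℚ (f ∘ F.suc)) (sumℚ (g ∘ F.suc)) x)
  where open ℚRing

-- Lattice points of the parallelepiped

p-difference : ∀ {d} n (h : 2 ≤ n) (lam : Fin d → ℕ) i j →
  p n h lam j -ᵖ p n h lam i ≡
    ( sumℤ (λ t → ceilc n h lam j t ℤ.- ceilc n h lam i t) ℤ.- (+ j ℤ.- + i)
    , λ t → ceilc n h lam j t ℤ.- ceilc n h lam i t)
p-difference n h lam i j = cong (_, λ t → ceilc n h lam j t ℤ.- ceilc n h lam i t)
  (trans (regroup (sumℤ (ceilc n h lam j)) (sumℤ (ceilc n h lam i)) (+ j) (+ i))
         (cong (ℤ._- (+ j ℤ.- + i)) (sym (sumℤ-homo-- (ceilc n h lam j) (ceilc n h lam i)))))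
  where
  regroup : ∀ a b x y → a ℤ.- x ℤ.- (b ℤ.- y) ≡ a ℤ.- b ℤ.- (x ℤ.- y)
  regroup = ℤRing.solve-∀

-- N stands for n - 1.
module Denominator (k : ℕ) where

  N : ℕ
  N = suc k

  Nℚ : ℚ
  Nℚ = ℤ→ℚ (+ N)

  instance
    Nℚ-positive : ℚ.Positive Nℚ
    Nℚ-positive = ℚ.positive (ℤ→ℚ-mono-< {+ 0} {+ N} (ℤ.+<+ z<s))

    Nℚ-nonNegative : ℚ.NonNegative Nℚ
    Nℚ-nonNegative = ℚ.nonNegative (ℤ→ℚ-mono-≤ {+ 0} {+ N} (ℤ.+≤+ z≤n))

  /N-scaled : ∀ z → (z ℚ./ N) ℚ.* Nℚ ≡ ℤ→ℚ z
  /N-scaled z = begin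
    (z ℚ./ N) ℚ.* Nℚ          ≡⟨ cong₂ ℚ._*_ /N≡*1/R (ℤ→ℚ-mkℚ (+ N)) ⟩
    ℤ→ℚ z ℚ.* ℚ.1/ R ℚ.* R    ≡⟨ ℚP.*-assoc (ℤ→ℚ z) (ℚ.1/ R) R ⟩
    ℤ→ℚ z ℚ.* (ℚ.1/ R ℚ.* R)  ≡⟨ cong (ℤ→ℚ z ℚ.*_) (ℚP.*-inverseˡ R) ⟩
    ℤ→ℚ z ℚ.* 1ℚ              ≡⟨ ℚP.*-identityʳ (ℤ→ℚ z) ⟩
    ℤ→ℚ z                     ∎
    where
    open ≡-Reasoning
    -- Nℚ in normal form, so that the reciprocal computes
    R : ℚ
    R = mkℚ (+ N) 0 (Coprime.sym (1-coprimeTo N))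
    /N≡*1/R : z ℚ./ N ≡ ℤ→ℚ z ℚ.* ℚ.1/ R
    /N≡*1/R rewrite ℤ→ℚ-mkℚ z = ℚP./-cong (sym (ℤP.*-identityʳ z)) (sym (+-identityʳ N))

  InUnit-scaled : ∀ {x z} → x ℚ.* Nℚ ≡ ℤ→ℚ z → InUnit x ⇔ (+ 0 ℤ.≤ z × z ℤ.< + N)
  InUnit-scaled {x} {z} xN≡z = mk⇔
    (λ (0≤x , x<1) →
      ℤ→ℚ-cancel-≤ (subst₂ ℚ._≤_ (ℚP.*-zeroˡ Nℚ) xN≡z (ℚP.*-monoʳ-≤-nonNeg Nℚ 0≤x)) ,
      ℤ→ℚ-cancel-< (subst₂ ℚ._<_ xN≡z (ℚP.*-identityˡ Nℚ) (ℚP.*-monoˡ-<-pos Nℚ x<1)))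
    (λ (0≤z , z<N) →
      ℚP.*-cancelʳ-≤-pos Nℚ (subst₂ ℚ._≤_ (sym (ℚP.*-zeroˡ Nℚ)) (sym xN≡z) (ℤ→ℚ-mono-≤ 0≤z)) ,
      ℚP.*-cancelʳ-<-nonNeg Nℚ (subst₂ ℚ._<_ (sym xN≡z) (sym (ℚP.*-identityˡ Nℚ)) (ℤ→ℚ-mono-< z<N)))

  ceiling-/⇔ : ∀ x z → ℚ.ceiling (x ℚ./ N) ≡ z ⇔ (+ 0 ℤ.≤ z ℤ.* + N ℤ.- x × z ℤ.* + N ℤ.- x ℤ.< + N)
  ceiling-/⇔ x z = InUnit-scaled scaled ⇔-∘ ceiling≡⇔InUnit (x ℚ./ N) z
    where
    open ℚRing using (_:-_; _:*_; _:=_)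
    scaled : (ℤ→ℚ z ℚ.- x ℚ./ N) ℚ.* Nℚ ≡ ℤ→ℚ (z ℤ.* + N ℤ.- x)
    scaled = begin
      (ℤ→ℚ z ℚ.- x ℚ./ N) ℚ.* Nℚ
        ≡⟨ ℚRing.solve 3 (λ a b n → (a :- b) :* n := a :* n :- b :* n) refl (ℤ→ℚ z) (x ℚ./ N) Nℚ ⟩
      ℤ→ℚ z ℚ.* Nℚ ℚ.- (x ℚ./ N) ℚ.* Nℚ
        ≡⟨ cong₂ ℚ._-_ (sym (ℤ→ℚ-homo-* z (+ N))) (/N-scaled x) ⟩
      ℤ→ℚ (z ℤ.* + N) ℚ.- ℤ→ℚ x
        ≡⟨ sym (ℤ→ℚ-homo-- (z ℤ.* + N) x) ⟩
      ℤ→ℚ (z ℤ.* + N ℤ.- x) ∎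
      where open ≡-Reasoning

  ceiling-/-ℕ : ∀ m → ℚ.ceiling (+ m ℚ./ N) ≡ + (m ⌈/⌉ N)
  ceiling-/-ℕ m = Equivalence.from (ceiling-/⇔ (+ m) (+ c))
    ( subst (+ 0 ℤ.≤_) (sym gap≡) (ℤ.+≤+ z≤n)
    , subst (ℤ._< + N) (sym gap≡) (ℤ.+<+ (m<n+o⇒m∸n<o (c * N) m (proj₂ (⌈/⌉-bounds m)))))
    where
    c : ℕ
    c = m ⌈/⌉ N
    gap≡ : + c ℤ.* + N ℤ.- + m ≡ + (c * N ∸ m)
    gap≡ = trans (cong (ℤ._- + m) (sym (ℤP.pos-* c N)))
                 (trans (ℤP.m-n≡m⊖n (c * N) m) (ℤP.⊖-≥ (proj₁ (⌈/⌉-bounds m))))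

  module _ {d} (lam : Fin d → ℕ) (Σλ≡ : sumℕ lam ≡ suc N) (e : ℤ) (v : Fin d → ℤ) where

    γ[_] : ℚ → Fin d → ℚ
    γ[ γ' ] t = ℤ→ℚ (v t) ℚ.- γ' ℚ.* ℤ→ℚ (+ lam t)

    sumγ+γ' : ∀ γ' → sumℚ γ[ γ' ] ℚ.+ γ' ≡ ℤ→ℚ (sumℤ v) ℚ.- γ' ℚ.* Nℚ
    sumγ+γ' γ' = begin
      sumℚ γ[ γ' ] ℚ.+ γ'
        ≡⟨ cong (ℚ._+ γ') (sumℚ-linear (ℤ→ℚ ∘ v) (ℤ→ℚ ∘ +_ ∘ lam) γ') ⟩
      sumℚ (ℤ→ℚ ∘ v) ℚ.- γ' ℚ.* sumℚ (ℤ→ℚ ∘ +_ ∘ lam) ℚ.+ γ'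
        ≡⟨ cong₂ (λ a b → a ℚ.- γ' ℚ.* b ℚ.+ γ') (sumℚ-ℤ→ℚ v) Σλℚ ⟩
      ℤ→ℚ (sumℤ v) ℚ.- γ' ℚ.* (Nℚ ℚ.+ 1ℚ) ℚ.+ γ'
        ≡⟨ solve 3 (λ s g n → s :- g :* (n :+ con 1ℚ) :+ g := s :- g :* n) refl (ℤ→ℚ (sumℤ v)) γ' Nℚ ⟩
      ℤ→ℚ (sumℤ v) ℚ.- γ' ℚ.* Nℚ ∎
      where
      open ≡-Reasoning
      open ℚRing
      Σλℚ : sumℚ (ℤ→ℚ ∘ +_ ∘ lam) ≡ Nℚ ℚ.+ 1ℚ
      Σλℚ = begin
        sumℚ (ℤ→ℚ ∘ +_ ∘ lam) ≡⟨ sumℚ-ℤ→ℚ (+_ ∘ lam) ⟩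
        ℤ→ℚ (sumℤ (+_ ∘ lam)) ≡⟨ cong ℤ→ℚ (sumℤ-pos lam) ⟩
        ℤ→ℚ (+ sumℕ lam)      ≡⟨ cong (λ n → ℤ→ℚ (+ n)) (trans Σλ≡ (+-comm 1 N)) ⟩
        ℤ→ℚ (+ N ℤ.+ + 1)     ≡⟨ ℤ→ℚ-homo-+ (+ N) (+ 1) ⟩
        Nℚ ℚ.+ 1ℚ             ∎

    height⇔ : ∀ γ' → ℤ→ℚ (sumℤ v ℤ.- e) ≡ sumℚ γ[ γ' ] ℚ.+ γ' ⇔ γ' ℚ.* Nℚ ≡ ℤ→ℚ e
    height⇔ γ' = mk⇔
      (λ eq → -‿cancelˡ (ℤ→ℚ (sumℤ v)) (trans (sym (ℤ→ℚ-homo-- (sumℤ v) e)) (trans eq (sumγ+γ' γ'))))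
      (λ eq → trans (ℤ→ℚ-homo-- (sumℤ v) e)
                    (trans (cong (ℚ._-_ (ℤ→ℚ (sumℤ v))) (sym eq)) (sym (sumγ+γ' γ'))))
      where
      s-[s-a]≡a : ∀ s a → s ℚ.- (s ℚ.- a) ≡ a
      s-[s-a]≡a = ℚRing.solve 2 (λ s a → s ℚRing.:- (s ℚRing.:- a) ℚRing.:= a) refl
      -‿cancelˡ : ∀ s {a b} → s ℚ.- a ≡ s ℚ.- b → b ≡ a
      -‿cancelˡ s {a} {b} eq =
        trans (sym (s-[s-a]≡a s b)) (trans (cong (ℚ._-_ s) (sym eq)) (s-[s-a]≡a s a))

    γ-scaled : ∀ γ' → γ' ℚ.* Nℚ ≡ ℤ→ℚ e → ∀ t → γ[ γ' ] t ℚ.* Nℚ ≡ ℤ→ℚ (v t ℤ.* + N ℤ.- e ℤ.* + lam t)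
    γ-scaled γ' γ'N≡e t = begin
      (ℤ→ℚ (v t) ℚ.- γ' ℚ.* ℤ→ℚ (+ lam t)) ℚ.* Nℚ
        ≡⟨ solve 4 (λ a g l n → (a :- g :* l) :* n := a :* n :- (g :* n) :* l) refl
                   (ℤ→ℚ (v t)) γ' (ℤ→ℚ (+ lam t)) Nℚ ⟩
      ℤ→ℚ (v t) ℚ.* Nℚ ℚ.- (γ' ℚ.* Nℚ) ℚ.* ℤ→ℚ (+ lam t)
        ≡⟨ cong₂ (λ a b → a ℚ.- b ℚ.* ℤ→ℚ (+ lam t)) (sym (ℤ→ℚ-homo-* (v t) (+ N))) γ'N≡e ⟩
      ℤ→ℚ (v t ℤ.* + N) ℚ.- ℤ→ℚ e ℚ.* ℤ→ℚ (+ lam t)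
        ≡⟨ cong (ℚ._-_ (ℤ→ℚ (v t ℤ.* + N))) (sym (ℤ→ℚ-homo-* e (+ lam t))) ⟩
      ℤ→ℚ (v t ℤ.* + N) ℚ.- ℤ→ℚ (e ℤ.* + lam t)
        ≡⟨ sym (ℤ→ℚ-homo-- (v t ℤ.* + N) (e ℤ.* + lam t)) ⟩
      ℤ→ℚ (v t ℤ.* + N ℤ.- e ℤ.* + lam t) ∎
      where
      open ≡-Reasoning
      open ℚRing

    LatticeCond : Set
    LatticeCond = (+ 0 ℤ.≤ e × e ℤ.< + N) × (∀ t → ℚ.ceiling ((e ℤ.* + lam t) ℚ./ N) ≡ v t)

    InΠ-lattice : InΠ lam (sumℤ v ℤ.- e , v) ⇔ LatticeCond
    InΠ-lattice = mk⇔ to from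
      where
      open ℚRing using (_:+_; _:-_; _:=_)
      to : InΠ lam (sumℤ v ℤ.- e , v) → LatticeCond
      to (γ , γ' , γ∈ , γ'∈ , height , coords) =
        Equivalence.to (InUnit-scaled γ'N≡e) γ'∈ ,
        λ t → Equivalence.from (ceiling-/⇔ _ _)
                (Equivalence.to (InUnit-scaled (γ-scaled γ' γ'N≡e t)) (subst InUnit (γ≡ t) (γ∈ t)))
        where
        γ≡ : ∀ t → γ t ≡ γ[ γ' ] t
        γ≡ t = trans (ℚRing.solve 2 (λ x y → x := (x :+ y) :- y) refl (γ t) (γ' ℚ.* ℤ→ℚ (+ lam t)))
                     (cong (ℚ._- γ' ℚ.* ℤ→ℚ (+ lam t)) (sym (coords t)))
        γ'N≡e : γ' ℚ.* Nℚ ≡ ℤ→ℚ e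
        γ'N≡e = Equivalence.to (height⇔ γ') (trans height (cong (ℚ._+ γ') (sumℚ-cong γ≡)))
      from : LatticeCond → InΠ lam (sumℤ v ℤ.- e , v)
      from (e∈ , ceilings) =
        γ[ e ℚ./ N ] , e ℚ./ N ,
        (λ t → Equivalence.from (InUnit-scaled (γ-scaled (e ℚ./ N) (/N-scaled e) t))
                 (Equivalence.to (ceiling-/⇔ _ _) (ceilings t))) ,
        Equivalence.from (InUnit-scaled (/N-scaled e)) e∈ ,
        Equivalence.from (height⇔ (e ℚ./ N)) (/N-scaled e) ,
        λ t → ℚRing.solve 2 (λ x y → x := (x :- y) :+ y) refl (ℤ→ℚ (v t)) ((e ℚ./ N) ℚ.* ℤ→ℚ (+ lam t))

  ceiling-gap⇔ResidueCond : ∀ A B →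
    ℚ.ceiling (+ B ℚ./ N) ≡ ℚ.ceiling (+ (A + B) ℚ./ N) ℤ.- ℚ.ceiling (+ A ℚ./ N) ⇔
    ResidueCond (A % N) (B % N) ((A + B) % N)
  ceiling-gap⇔ResidueCond A B =
    ⌈/⌉-+⇔ResidueCond A B ⇔-∘ (b≡s-a⇔s≡a+b (A ⌈/⌉ N) (B ⌈/⌉ N) ((A + B) ⌈/⌉ N) ⇔-∘ mk⇔
      (λ eq → trans (sym (ceiling-/-ℕ B)) (trans eq ceilings≡))
      (λ eq → trans (ceiling-/-ℕ B) (trans eq (sym ceilings≡))))
    where
    ceilings≡ : ℚ.ceiling (+ (A + B) ℚ./ N) ℤ.- ℚ.ceiling (+ A ℚ./ N) ≡ + ((A + B) ⌈/⌉ N) ℤ.- + (A ⌈/⌉ N)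
    ceilings≡ = cong₂ ℤ._-_ (ceiling-/-ℕ (A + B)) (ceiling-/-ℕ A)

  gap⇔ResidueCond : ∀ {i j} l → i ≤ j →
    ℚ.ceiling (((+ j ℤ.- + i) ℤ.* + l) ℚ./ N) ≡ ℚ.ceiling (+ (j * l) ℚ./ N) ℤ.- ℚ.ceiling (+ (i * l) ℚ./ N) ⇔
    ResidueCond ((i * l) % N) (((j ∸ i) * l) % N) ((j * l) % N)
  gap⇔ResidueCond {i} {j} l i≤j
    rewrite ℤP.m-n≡m⊖n j i | ℤP.⊖-≥ i≤j | sym (ℤP.pos-* (j ∸ i) l)
          | cong (_* l) (sym (m+[n∸m]≡n i≤j)) | *-distribʳ-+ l i (j ∸ i)
    = ceiling-gap⇔ResidueCond (i * l) ((j ∸ i) * l)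

  height-bounds⇔ : ∀ {i j} → j < N → (+ 0 ℤ.≤ + j ℤ.- + i × + j ℤ.- + i ℤ.< + N) ⇔ i ≤ j
  height-bounds⇔ {i} {j} j<N = mk⇔
    (λ (0≤j-i , _) → ℤP.drop‿+≤+ (ℤP.0≤i-j⇒j≤i 0≤j-i))
    (λ i≤j → ℤP.i≤j⇒0≤j-i (ℤ.+≤+ i≤j)
           , subst (ℤ._< + N) (sym (j-i≡ i≤j)) (ℤ.+<+ (≤-<-trans (m∸n≤m j i) j<N)))
    where
    j-i≡ : i ≤ j → + j ℤ.- + i ≡ + (j ∸ i)
    j-i≡ i≤j = trans (ℤP.m-n≡m⊖n j i) (ℤP.⊖-≥ i≤j)

  Prec⇔≤×Cond : ∀ {d} h (lam : Fin d → ℕ) → sumℕ lam ≡ suc N → ∀ {i j} → j < N →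
                Prec (suc N) h lam i j ⇔ (i ≤ j × ∀ t → Cond (suc N) h lam i j t)
  Prec⇔≤×Cond {d} h lam Σλ≡ {i} {j} j<N = mk⇔
    (λ prec →
      let e∈ , gaps = Equivalence.to lattice (subst (InΠ lam) point≡ prec)
          i≤j       = Equivalence.to (height-bounds⇔ j<N) e∈
      in i≤j , λ t → Equivalence.to (gap⇔ResidueCond (lam t) i≤j) (gaps t))
    (λ (i≤j , conds) → subst (InΠ lam) (sym point≡) (Equivalence.from lattice
      ( Equivalence.from (height-bounds⇔ j<N) i≤j
      , λ t → Equivalence.from (gap⇔ResidueCond (lam t) i≤j) (conds t))))
    where
    v : Fin d → ℤ
    v t = ceilc (suc N) h lam j t ℤ.- ceilc (suc N) h lam i t
    point≡ : p (suc N) h lam j -ᵖ p (suc N) h lam i ≡ (sumℤ v ℤ.- (+ j ℤ.- + i) , v)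
    point≡ = p-difference (suc N) h lam i j
    lattice : InΠ lam (sumℤ v ℤ.- (+ j ℤ.- + i) , v) ⇔ LatticeCond lam Σλ≡ (+ j ℤ.- + i) v
    lattice = InΠ-lattice lam Σλ≡ (+ j ℤ.- + i) v

theorem2p17 : (n : ℕ) (h : 2 ≤ n) (d : ℕ) (lam : Fin d → ℕ) → IsPartition n lam →
    (i j : ℕ) → i < n ∸ 1 → j < n ∸ 1 → i ≢ j →
    Prec n h lam i j ⇔ (i < j × (∀ t → Cond n h lam i j t))
theorem2p17 (suc (suc k)) h d lam (_ , Σλ≡n , _) i j _ j<N i≢j =
  mk⇔ (map₁ (λ i≤j → ≤∧≢⇒< i≤j i≢j)) (map₁ <⇒≤) ⇔-∘ Prec⇔≤×Cond h lam Σλ≡n j<N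
  where open Denominator k
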